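{- Fix an integer $B\geq 2$. If $z\in\mathbb{Z}[i]$ is a Gaussian $B$-happy number, then so are $-z$, $\pm iz$, $\pm\overline{z}$, and $\pm i\overline{z}$.
   Context: Fix an integer $B\ge 2$. Every nonzero Gaussian integer $a+bi$ is written uniquely as $a+bi=\sum_{j=0}^n (a_j+b_ji)B^j$ with $a_j,b_j\in\mathbb{Z}$, $a_n,b_n$ not both $0$, and for each $j$: $|a_j|\le B-1$, $|b_j|\le B-1$, $\operatorname{sgn}(a)a_j\ge 0$, $\operatorname{sgn}(b)b_j\ge 0$ (i.e. the digits of $a$ and of $b$ are the base-$B$ digits of $|a|$, $|b|$ carrying the sign of $a$, resp. $b$). The Gaussian $B$-happy function $S_B:\mathbb{Z}[i]\to\mathbb{Z}[i]$ is defined by $S_B(0)=0$ and $S_B(a+bi)=\sum_{j=0}^n (a_j+b_ji)^2=\sum_j(a_j^2-b_j^2)+2\left(\sum_j a_jb_j\right)i$. A Gaussian integer $z$ is a (Gaussian) $B$-happy number if $S_B^k(z)=1$ for some integer $k\ge 1$, where $S_B^k$ denotes the $k$-fold iterate. -}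

module Defs where

open import Data.Nat as ℕ using (ℕ; zero; suc; NonZero; _≤_)
open import Data.Nat.DivMod using (_/_; _%_)
open import Data.Integer as ℤ using (ℤ; +_; -[1+_]; ∣_∣; sign; _◃_)
open import Data.List using (List; []; _∷_; map)
open import Data.Product using (_×_; _,_; proj₁; proj₂; ∃-syntax)
open import Relation.Binary.PropositionalEquality using (_≡_)

-- Gaussian integers a + b i represented as pairs (a , b)
ℤ[i] : Set
ℤ[i] = ℤ × ℤ

one : ℤ[i]
one = (+ 1 , + 0)

neg : ℤ[i] → ℤ[i]
neg (a , b) = (ℤ.- a , ℤ.- b)

mulI : ℤ[i] → ℤ[i]
mulI (a , b) = (ℤ.- b , a)

conj : ℤ[i] → ℤ[i]
conj (a , b) = (a , ℤ.- b)

-- base-B digits of a natural number n, least significant first,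
-- with no leading zeros (digitsℕ B 0 = []).  Fuel argument ≥ n ensures termination.
digitsFuel : (B : ℕ) → .{{NonZero B}} → ℕ → ℕ → List ℕ
digitsFuel B zero    n       = []
digitsFuel B (suc f) zero    = []
digitsFuel B (suc f) (suc n) = (suc n % B) ∷ digitsFuel B f (suc n / B)

digitsℕ : (B : ℕ) → .{{NonZero B}} → ℕ → List ℕ
digitsℕ B n = digitsFuel B n n

digitsℤ : (B : ℕ) → .{{NonZero B}} → ℤ → List ℤ
digitsℤ B a = map (λ d → sign a ◃ d) (digitsℕ B ∣ a ∣)

-- sum over j of (a_j + b_j i)^2, padding the shorter digit list with zeros
sqSum : List ℤ → List ℤ → ℤ[i]
sqSum []       []       = (+ 0 , + 0)
sqSum (x ∷ xs) []       = let (u , v) = sqSum xs [] in (x ℤ.* x ℤ.+ u , v)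
sqSum []       (y ∷ ys) = let (u , v) = sqSum [] ys in (ℤ.- (y ℤ.* y) ℤ.+ u , v)
sqSum (x ∷ xs) (y ∷ ys) = let (u , v) = sqSum xs ys in
  (x ℤ.* x ℤ.- y ℤ.* y ℤ.+ u , (+ 2) ℤ.* (x ℤ.* y) ℤ.+ v)

-- Gaussian B-happy function S_B (S_B 0 = 0 holds since both digit lists are empty)
S : (B : ℕ) → .{{NonZero B}} → ℤ[i] → ℤ[i]
S B (a , b) = sqSum (digitsℤ B a) (digitsℤ B b)

iter : {A : Set} → (A → A) → ℕ → A → A
iter f zero    x = x
iter f (suc k) x = f (iter f k x)

Happy : (B : ℕ) → .{{NonZero B}} → ℤ[i] → Set
Happy B z = ∃[ k ] (1 ℕ.≤ k × iter (S B) k z ≡ one)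

{-# OPTIONS --safe #-}

-- The signed digits of -a are the negated digits of a. Since S_B squares digits,
-- S_B(-z) = S_B(z), S_B(z̄) = conj (S_B(z)) and S_B(iz) = -S_B(z). Conjugation fixes 1
-- and commutes with S_B, so it preserves happiness; -z and z (resp. iz and z) agree
-- after one (resp. two) applications of S_B, and since S_B(1) = 1 for B ≥ 2 a
-- happy number stays happy when replaced by anything with the same later iterates.
module Submission where

open import Defs
open import Data.Nat as ℕ using (ℕ; _≥_; NonZero; zero; suc; s≤s)
open import Data.Nat.Properties using (+-comm; ≤-trans; m≤m+n)
open import Data.Integer.Properties using (neg-involutive; neg-distrib-+)
open import Data.Product using (_×_; _,_; proj₁; proj₂)
open import Data.Integer using (ℤ; +_; -[1+_]; +[1+_]; _◃_; -_; _+_; _-_; _*_)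
open import Data.Integer.Tactic.RingSolver using (solve-∀)
import Data.Sign as Sign
open import Data.List using (List; []; _∷_; map)
open import Data.List.Properties using (map-cong; map-∘)
open import Relation.Binary.PropositionalEquality using (_≡_; refl; sym; trans; cong; cong₂; module ≡-Reasoning)

module _ {A : Set} (f : A → A) where

  iter-+ : ∀ m n x → iter f (m ℕ.+ n) x ≡ iter f m (iter f n x)
  iter-+ zero    n x = refl
  iter-+ (suc m) n x = cong f (iter-+ m n x)

  iter-fixed : ∀ {p} → f p ≡ p → ∀ n → iter f n p ≡ p
  iter-fixed fp≡p zero    = refl
  iter-fixed fp≡p (suc n) = trans (cong f (iter-fixed fp≡p n)) fp≡p

  iter-commute : ∀ {g : A → A} → (∀ x → f (g x) ≡ g (f x)) → ∀ n x → iter f n (g x) ≡ g (iter f n x)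
  iter-commute fg≡gf zero    x = refl
  iter-commute fg≡gf (suc n) x = trans (cong f (iter-commute fg≡gf n x)) (fg≡gf _)

negate : List ℤ → List ℤ
negate = map (-_)

neg-◃ : ∀ s n → Sign.opposite s ◃ n ≡ - (s ◃ n)
neg-◃ Sign.- zero    = refl
neg-◃ Sign.+ zero    = refl
neg-◃ Sign.- (suc n) = refl
neg-◃ Sign.+ (suc n) = refl

digitsℤ-neg : ∀ B .{{_ : NonZero B}} a → digitsℤ B (- a) ≡ negate (digitsℤ B a)
digitsℤ-neg B (+ zero)  = refl
digitsℤ-neg B +[1+ n ]  = trans (map-cong (neg-◃ Sign.+) _) (map-∘ _)
digitsℤ-neg B -[1+ n ]  = trans (map-cong (neg-◃ Sign.-) _) (map-∘ _)

neg-*-neg : ∀ x y → (- x) * (- y) ≡ x * y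
neg-*-neg = solve-∀

+-neg-distrib : ∀ {a b c d} → a ≡ - b → c ≡ - d → a + c ≡ - (b + d)
+-neg-distrib {b = b} {d = d} a≡-b c≡-d = trans (cong₂ _+_ a≡-b c≡-d) (sym (neg-distrib-+ b d))

sqSum-negate-negate : ∀ xs ys → sqSum (negate xs) (negate ys) ≡ sqSum xs ys
sqSum-negate-negate []       []       = refl
sqSum-negate-negate (x ∷ xs) []       =
  cong₂ _,_ (cong₂ _+_ (neg-*-neg x x) (cong proj₁ ih)) (cong proj₂ ih)
  where ih = sqSum-negate-negate xs []
sqSum-negate-negate []       (y ∷ ys) =
  cong₂ _,_ (cong₂ _+_ (cong -_ (neg-*-neg y y)) (cong proj₁ ih)) (cong proj₂ ih)
  where ih = sqSum-negate-negate [] ys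
sqSum-negate-negate (x ∷ xs) (y ∷ ys) =
  cong₂ _,_ (cong₂ _+_ (cong₂ _-_ (neg-*-neg x x) (neg-*-neg y y)) (cong proj₁ ih))
            (cong₂ _+_ (cong (+ 2 *_) (neg-*-neg x y)) (cong proj₂ ih))
  where ih = sqSum-negate-negate xs ys

sqSum-negateʳ : ∀ xs ys → sqSum xs (negate ys) ≡ conj (sqSum xs ys)
sqSum-negateʳ []       []       = refl
sqSum-negateʳ (x ∷ xs) []       =
  cong₂ _,_ (cong (λ t → x * x + t) (cong proj₁ ih)) (cong proj₂ ih)
  where ih = sqSum-negateʳ xs []
sqSum-negateʳ []       (y ∷ ys) =
  cong₂ _,_ (cong₂ _+_ (cong -_ (neg-*-neg y y)) (cong proj₁ ih)) (cong proj₂ ih)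
  where ih = sqSum-negateʳ [] ys
sqSum-negateʳ (x ∷ xs) (y ∷ ys) =
  cong₂ _,_ (cong₂ _+_ (cong (λ t → x * x - t) (neg-*-neg y y)) (cong proj₁ ih))
            (+-neg-distrib (twice-product x y) (cong proj₂ ih))
  where
    ih = sqSum-negateʳ xs ys
    twice-product : ∀ x y → + 2 * (x * - y) ≡ - (+ 2 * (x * y))
    twice-product = solve-∀

sqSum-swap-negate : ∀ xs ys → sqSum (negate ys) xs ≡ neg (sqSum xs ys)
sqSum-swap-negate []       []       = refl
sqSum-swap-negate (x ∷ xs) []       =
  cong₂ _,_ (+-neg-distrib {a = - (x * x)} refl (cong proj₁ ih)) (cong proj₂ ih)
  where ih = sqSum-swap-negate xs []
sqSum-swap-negate []       (y ∷ ys) =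
  cong₂ _,_ (+-neg-distrib (trans (neg-*-neg y y) (sym (neg-involutive _))) (cong proj₁ ih))
            (cong proj₂ ih)
  where ih = sqSum-swap-negate [] ys
sqSum-swap-negate (x ∷ xs) (y ∷ ys) =
  cong₂ _,_ (+-neg-distrib (real-part x y) (cong proj₁ ih))
            (+-neg-distrib (imaginary-part x y) (cong proj₂ ih))
  where
    ih = sqSum-swap-negate xs ys
    real-part : ∀ x y → (- y) * (- y) - x * x ≡ - (x * x - y * y)
    real-part = solve-∀
    imaginary-part : ∀ x y → + 2 * ((- y) * x) ≡ - (+ 2 * (x * y))
    imaginary-part = solve-∀

module _ (B : ℕ) .{{_ : NonZero B}} where

  S-neg : ∀ z → S B (neg z) ≡ S B z
  S-neg (a , b) =
    trans (cong₂ sqSum (digitsℤ-neg B a) (digitsℤ-neg B b)) (sqSum-negate-negate _ _)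

  S-conj : ∀ z → S B (conj z) ≡ conj (S B z)
  S-conj (a , b) = trans (cong (sqSum _) (digitsℤ-neg B b)) (sqSum-negateʳ _ _)

  S-mulI : ∀ z → S B (mulI z) ≡ neg (S B z)
  S-mulI (a , b) = trans (cong (λ ds → sqSum ds _) (digitsℤ-neg B b)) (sqSum-swap-negate _ _)

  happy-conj : ∀ {z} → Happy B z → Happy B (conj z)
  happy-conj {z} (k , 1≤k , Sᵏz≡1) =
    k , 1≤k , trans (iter-commute (S B) S-conj k z) (cong conj Sᵏz≡1)

  module _ (S-one : S B one ≡ one) where

    happy-of-iterates : ∀ n {z w} → iter (S B) n w ≡ iter (S B) n z → Happy B z → Happy B w
    happy-of-iterates n {z} {w} Sⁿw≡Sⁿz (k , 1≤k , Sᵏz≡1) = k ℕ.+ n , ≤-trans 1≤k (m≤m+n k n) , (begin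
      iter (S B) (k ℕ.+ n) w      ≡⟨ iter-+ (S B) k n w ⟩
      iter (S B) k (iter (S B) n w) ≡⟨ cong (iter (S B) k) Sⁿw≡Sⁿz ⟩
      iter (S B) k (iter (S B) n z) ≡⟨ sym (iter-+ (S B) k n z) ⟩
      iter (S B) (k ℕ.+ n) z      ≡⟨ cong (λ m → iter (S B) m z) (+-comm k n) ⟩
      iter (S B) (n ℕ.+ k) z      ≡⟨ iter-+ (S B) n k z ⟩
      iter (S B) n (iter (S B) k z) ≡⟨ cong (iter (S B) n) Sᵏz≡1 ⟩
      iter (S B) n one            ≡⟨ iter-fixed (S B) S-one n ⟩
      one                         ∎)
      where open ≡-Reasoning

    happy-neg : ∀ {z} → Happy B z → Happy B (neg z)
    happy-neg {z} = happy-of-iterates 1 (S-neg z)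

    happy-mulI : ∀ {z} → Happy B z → Happy B (mulI z)
    happy-mulI {z} = happy-of-iterates 2 (trans (cong (S B) (S-mulI z)) (S-neg (S B z)))

S-one : ∀ B .{{_ : NonZero B}} → B ≥ 2 → S B one ≡ one
S-one _ (s≤s (s≤s _)) = refl

lemma2 : (B : ℕ) → .{{_ : NonZero B}} → B ≥ 2 → (z : ℤ[i]) → Happy B z →
    Happy B (neg z) × Happy B (mulI z) × Happy B (neg (mulI z))
      × Happy B (conj z) × Happy B (neg (conj z))
      × Happy B (mulI (conj z)) × Happy B (neg (mulI (conj z)))
lemma2 B B≥2 z happy =
  neg′ happy , mulI′ happy , neg′ (mulI′ happy) ,
  conj′ , neg′ conj′ , mulI′ conj′ , neg′ (mulI′ conj′)
  where
    neg′ : ∀ {w} → Happy B w → Happy B (neg w)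
    neg′ = happy-neg B (S-one B B≥2)
    mulI′ : ∀ {w} → Happy B w → Happy B (mulI w)
    mulI′ = happy-mulI B (S-one B B≥2)
    conj′ : Happy B (conj z)
    conj′ = happy-conj B happy
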